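{- Let $G$ be a connected, reduced bipartite graph whose smallest partite set has size $m$. Then $\mathcal{R}(G)\le 1+\lceil \frac m2\rceil$.
   Context: A word over a finite set is a finite sequence of its elements; letters $x,y$ alternate in a word $w$ if the subsequence of $w$ consisting of occurrences of $x$ and $y$ is $xyxy\cdots$ or $yxyx\cdots$. A graph $G$ is word-representable if there is a word $w$ over its vertex set (containing every vertex) such that two vertices are adjacent iff they alternate in $w$. A word is $k$-uniform if each letter occurs exactly $k$ times; $G$ is $k$-representable if it has a $k$-uniform word-representant. The representation number $\mathcal{R}(G)$ is the least $k$ such that $G$ is $k$-representable. A graph is reduced if no two vertices have the same neighborhood. -}

module Defs where

open import Data.Nat using (ℕ; zero; suc; _⊔_; _⊓_; _≤_; _+_; ⌈_/2⌉)
open import Data.Fin using (Fin; _≟_)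
open import Data.Bool using (Bool; true; false; T; not)
open import Data.List using (List; []; _∷_; filter; length; allFin)
open import Data.List.Membership.Propositional using (_∈_)
open import Data.Product using (Σ; _×_; ∃; ∃-syntax)
open import Data.Sum using (_⊎_)
open import Relation.Nullary using (¬_)
open import Relation.Unary using (Decidable)
open import Relation.Nullary.Decidable using (_⊎-dec_)
open import Relation.Binary.PropositionalEquality using (_≡_; _≢_)
open import Function.Bundles using (_⇔_)

record Graph (n : ℕ) : Set where
  field
    Adj   : Fin n → Fin n → Bool
    sym   : ∀ x y → Adj x y ≡ Adj y x
    irrefl : ∀ x → Adj x x ≡ false
open Graph public

Word : ℕ → Set
Word n = List (Fin n)

restrict : ∀ {n} → Fin n → Fin n → Word n → Word n
restrict x y w = filter (λ z → (z ≟ x) ⊎-dec (z ≟ y)) w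

altWord : ∀ {n} → Fin n → Fin n → ℕ → Word n
altWord x y zero = []
altWord x y (suc k) = x ∷ altWord y x k

Alternate : ∀ {n} → Fin n → Fin n → Word n → Set
Alternate x y w =
  ∃[ k ] (restrict x y w ≡ altWord x y k ⊎ restrict x y w ≡ altWord y x k)

occ : ∀ {n} → Fin n → Word n → ℕ
occ v w = length (filter (λ z → z ≟ v) w)

Represents : ∀ {n} → Graph n → Word n → Set
Represents {n} G w =
  (∀ v → v ∈ w) ×
  (∀ x y → x ≢ y → (T (Adj G x y) ⇔ Alternate x y w))

Uniform : ∀ {n} → ℕ → Word n → Set
Uniform {n} k w = ∀ (v : Fin n) → occ v w ≡ k

KRepresentable : ∀ {n} → ℕ → Graph n → Set
KRepresentable k G = ∃[ w ] (Uniform k w × Represents G w)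

-- R(G) ≤ b  (R(G) is the least k with G k-representable)
RepNumberAtMost : ∀ {n} → Graph n → ℕ → Set
RepNumberAtMost G b = ∃[ k ] (k ≤ b × KRepresentable k G)

data Reachable {n} (G : Graph n) : Fin n → Fin n → Set where
  here : ∀ {x} → Reachable G x x
  step : ∀ {x y z} → T (Adj G x y) → Reachable G y z → Reachable G x z

Connected : ∀ {n} → Graph n → Set
Connected {n} G = ∀ (x y : Fin n) → Reachable G x y

Reduced : ∀ {n} → Graph n → Set
Reduced {n} G = ∀ (x y : Fin n) → (∀ z → Adj G x z ≡ Adj G y z) → x ≡ y

ProperBipartition : ∀ {n} → Graph n → (Fin n → Bool) → Set
ProperBipartition G c = ∀ x y → T (Adj G x y) → c x ≢ c y

partSize : ∀ {n} → (Fin n → Bool) → Bool → ℕ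
partSize {n} c b = length (filter (λ v → c v Data.Bool.≟ b) (allFin n))

smallestPart : ∀ {n} → (Fin n → Bool) → ℕ
smallestPart c = partSize c true ⊓ partSize c false

module Submission where

-- Let A be the smaller side of the bipartition, m = |A| and t = ⌈m/2⌉.  Rank the vertices of A
-- as 0, …, m − 1; in round ρ the vertices of rank 2ρ + 1 and 2ρ play the roles P and Q, except
-- that the rank-0 vertex acts as the Q-vertex of the last round t.  The word is the concatenation
-- of the rounds 0, …, t, each listing every vertex once, except that the P- and Q-vertex of the
-- round occur twice, with exactly their neighbours in B between the two copies, and are absent
-- from the next round (the rank-0 vertex is absent from round t − 1 and last in earlier rounds).
-- So every letter occurs t + 1 times, and restricted to a pair of letters:
--  * a ∈ A and b ∈ B give (ab)* aba b (ab)*, or (ba)* b aba for rank 0, which alternates iff ab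
--    is an edge;
--  * two letters of A never alternate: in the round where one is doubled the other occurs at
--    most once, unless they are the P- and Q-vertex of the same round ρ ≥ 1, which give P Q P Q
--    right after round ρ − 1 listed them in the order Q P;
--  * two letters of B occur once per round, and the last round lists B in the reverse order of
--    round 0.

open import Defs renaming (sym to Adj-sym)
open import Data.Bool as Bool using (Bool; true; false; T; _∧_; if_then_else_)
open import Data.Bool.Properties using (T-≡; T-∧; ∨-identityʳ; ∨-comm; ⇔→≡; ¬-not)
open import Data.Empty using (⊥; ⊥-elim)
open import Data.Fin as Fin using (Fin; toℕ; _≟_)
open import Data.Fin.Properties using (toℕ-injective)
open import Data.List using (List; []; _∷_; [_]; _++_; map; reverse; length; filter; filterᵇ; allFin; upTo)
open import Data.Bool.ListAction using (any)
open import Data.List.Properties using (∷-injectiveˡ; filter-++; unfold-reverse; ++-identityʳ; ++-assoc; length-++; map-tabulate)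
open import Data.List.Relation.Unary.Linked as Linked using (Linked; []; [-]; _∷_)
open import Data.List.Relation.Unary.Any using (here; there)
open import Data.List.Relation.Unary.Any.Properties using (any⁺; any⁻)
open import Data.List.Membership.Propositional using (_∈_; find; lose)
open import Data.List.Membership.Propositional.Properties using (∈-allFin)
open import Data.Nat as ℕ
  using (ℕ; _≡ᵇ_; zero; suc; _+_; _*_; _∸_; _≤_; _<_; _<?_; _≤′_; ≤′-refl; ≤′-step; z≤n; s≤s; ⌊_/2⌋; ⌈_/2⌉)
open import Data.Nat.Properties hiding (_≟_)
open import Data.Parity.Base using (Parity; 0ℙ; 1ℙ)
open import Data.Nat.Base using (parity; >-nonZero)
open import Relation.Binary.Definitions using (tri<; tri≈; tri>)
open import Data.Product using (_,_; ∃-syntax; proj₁; proj₂)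
open import Data.Sum using (_⊎_; inj₁; inj₂)
open import Function using (_∘_; id; case_of_)
open import Function.Bundles using (_⇔_; mk⇔; Equivalence)
open import Relation.Binary.PropositionalEquality using (_≡_; _≢_; refl; sym; trans; cong; cong₂; subst; subst₂; module ≡-Reasoning)
open import Relation.Nullary using (¬_; yes; no; does)
open import Relation.Nullary.Decidable using (T?; _×-dec_; dec-true; dec-false)
open import Relation.Unary using (Pred; Decidable)

T-≡⁻¹ : ∀ {b} → b ≡ true → T b
T-≡⁻¹ = Equivalence.from T-≡

-- Lists

module _ {A : Set} where

  filter-cong : ∀ {ℓ ℓ′} {P : Pred A ℓ} {Q : Pred A ℓ′} (P? : Decidable P) (Q? : Decidable Q) →
                (∀ x → does (P? x) ≡ does (Q? x)) → ∀ xs → filter P? xs ≡ filter Q? xs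
  filter-cong P? Q? P≗Q [] = refl
  filter-cong P? Q? P≗Q (x ∷ xs) rewrite P≗Q x with does (Q? x)
  ... | true  = cong (x ∷_) (filter-cong P? Q? P≗Q xs)
  ... | false = filter-cong P? Q? P≗Q xs

  filter-reject-all : ∀ {ℓ} {P : Pred A ℓ} (P? : Decidable P) →
                      (∀ x → does (P? x) ≡ false) → ∀ xs → filter P? xs ≡ []
  filter-reject-all P? ¬P [] = refl
  filter-reject-all P? ¬P (x ∷ xs) rewrite ¬P x = filter-reject-all P? ¬P xs

  filter-comm : ∀ {ℓ ℓ′} {P : Pred A ℓ} {Q : Pred A ℓ′} (P? : Decidable P) (Q? : Decidable Q) →
                ∀ xs → filter P? (filter Q? xs) ≡ filter Q? (filter P? xs)
  filter-comm P? Q? [] = refl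
  filter-comm P? Q? (x ∷ xs) with does (Q? x) in qx | does (P? x) in px
  ... | true  | true  rewrite qx | px = cong (x ∷_) (filter-comm P? Q? xs)
  ... | true  | false rewrite px = filter-comm P? Q? xs
  ... | false | true  rewrite qx = filter-comm P? Q? xs
  ... | false | false = filter-comm P? Q? xs

  filter-reverse : ∀ {ℓ} {P : Pred A ℓ} (P? : Decidable P) →
                   ∀ xs → filter P? (reverse xs) ≡ reverse (filter P? xs)
  filter-reverse P? [] = refl
  filter-reverse P? (x ∷ xs)
    rewrite unfold-reverse x xs | filter-++ P? (reverse xs) [ x ] | filter-reverse P? xs
    with does (P? x)
  ... | true  = sym (unfold-reverse x (filter P? xs))
  ... | false = ++-identityʳ _

  filter-map : ∀ {B : Set} {ℓ} {P : Pred B ℓ} (P? : Decidable P) (f : A → B) →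
               ∀ xs → filter P? (map f xs) ≡ map f (filter (P? ∘ f) xs)
  filter-map P? f [] = refl
  filter-map P? f (x ∷ xs) with does (P? (f x))
  ... | true  = cong (f x ∷_) (filter-map P? f xs)
  ... | false = filter-map P? f xs

  length-filter-⊆ : ∀ {ℓ ℓ′} {P : Pred A ℓ} {Q : Pred A ℓ′} (P? : Decidable P) (Q? : Decidable Q) →
                    (∀ {x} → P x → Q x) → ∀ xs → length (filter P? xs) ≤ length (filter Q? xs)
  length-filter-⊆ P? Q? P⊆Q [] = z≤n
  length-filter-⊆ P? Q? P⊆Q (x ∷ xs) with P? x | Q? x
  ... | yes _  | yes _  = s≤s (length-filter-⊆ P? Q? P⊆Q xs)
  ... | yes px | no ¬qx = ⊥-elim (¬qx (P⊆Q px))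
  ... | no _   | yes _  = m≤n⇒m≤1+n (length-filter-⊆ P? Q? P⊆Q xs)
  ... | no _   | no _   = length-filter-⊆ P? Q? P⊆Q xs

  length-filter-⊂ : ∀ {ℓ ℓ′} {P : Pred A ℓ} {Q : Pred A ℓ′} (P? : Decidable P) (Q? : Decidable Q) →
                    (∀ {x} → P x → Q x) → ∀ {x xs} → x ∈ xs → ¬ P x → Q x →
                    length (filter P? xs) < length (filter Q? xs)
  length-filter-⊂ P? Q? P⊆Q {xs = x ∷ xs} (here refl) ¬px qx with P? x | Q? x
  ... | yes px | _      = ⊥-elim (¬px px)
  ... | no _   | yes _  = s≤s (length-filter-⊆ P? Q? P⊆Q xs)
  ... | no _   | no ¬qx = ⊥-elim (¬qx qx)
  length-filter-⊂ P? Q? P⊆Q {xs = y ∷ xs} (there x∈xs) ¬px qx with P? y | Q? y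
  ... | yes _  | yes _  = s≤s (length-filter-⊂ P? Q? P⊆Q x∈xs ¬px qx)
  ... | yes py | no ¬qy = ⊥-elim (¬qy (P⊆Q py))
  ... | no _   | yes _  = m≤n⇒m≤1+n (length-filter-⊂ P? Q? P⊆Q x∈xs ¬px qx)
  ... | no _   | no _   = length-filter-⊂ P? Q? P⊆Q x∈xs ¬px qx

  Linked-++⁻ˡ : ∀ {ℓ} {R : A → A → Set ℓ} xs {ys} → Linked R (xs ++ ys) → Linked R xs
  Linked-++⁻ˡ []           _       = []
  Linked-++⁻ˡ (x ∷ [])     _       = [-]
  Linked-++⁻ˡ (x ∷ y ∷ xs) (r ∷ l) = r ∷ Linked-++⁻ˡ (y ∷ xs) l

  Linked-++⁻ʳ : ∀ {ℓ} {R : A → A → Set ℓ} xs {ys} → Linked R (xs ++ ys) → Linked R ys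
  Linked-++⁻ʳ []       l = l
  Linked-++⁻ʳ (x ∷ xs) l = Linked-++⁻ʳ xs (Linked.tail l)

  concatUpTo : (ℕ → List A) → ℕ → List A
  concatUpTo g zero    = []
  concatUpTo g (suc k) = concatUpTo g k ++ g k

  concatUpTo-prefix : ∀ (g : ℕ → List A) {i j} → i ≤′ j → ∃[ s ] concatUpTo g j ≡ concatUpTo g i ++ s
  concatUpTo-prefix g ≤′-refl = [] , sym (++-identityʳ _)
  concatUpTo-prefix g {i} (≤′-step {j} i≤j) with concatUpTo-prefix g i≤j
  ... | s , eq = s ++ g j , trans (cong (_++ g j) eq) (++-assoc (concatUpTo g i) s (g j))

  filter-concatUpTo : ∀ {ℓ} {P : Pred A ℓ} (P? : Decidable P) (g : ℕ → List A) →
                      ∀ k → filter P? (concatUpTo g k) ≡ concatUpTo (filter P? ∘ g) k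
  filter-concatUpTo P? g zero    = refl
  filter-concatUpTo P? g (suc k) =
    trans (filter-++ P? (concatUpTo g k) (g k)) (cong (_++ filter P? (g k)) (filter-concatUpTo P? g k))

  slotWord : (ℕ → A → Bool) → List ℕ → List A → List A
  slotWord occurs []       xs = []
  slotWord occurs (s ∷ ss) xs = filterᵇ (occurs s) xs ++ slotWord occurs ss xs

  twoLetterWord : (ℕ → Bool) → (ℕ → Bool) → A → A → List ℕ → List A
  twoLetterWord f g x y []       = []
  twoLetterWord f g x y (s ∷ ss) =
    (if f s then x ∷ [] else []) ++ (if g s then y ∷ [] else []) ++ twoLetterWord f g x y ss

  filter-slotWord : ∀ {ℓ} {P : Pred A ℓ} (P? : Decidable P) occurs ss xs →
                    filter P? (slotWord occurs ss xs) ≡ slotWord occurs ss (filter P? xs)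
  filter-slotWord P? occurs []       xs = refl
  filter-slotWord P? occurs (s ∷ ss) xs
    rewrite filter-++ P? (filterᵇ (occurs s) xs) (slotWord occurs ss xs)
          | filter-comm P? (T? ∘ occurs s) xs
          | filter-slotWord P? occurs ss xs = refl

  slotWord-pair : ∀ occurs ss (x y : A) →
                  slotWord occurs ss (x ∷ y ∷ []) ≡ twoLetterWord (λ s → occurs s x) (λ s → occurs s y) x y ss
  slotWord-pair occurs []       x y = refl
  slotWord-pair occurs (s ∷ ss) x y with occurs s x | occurs s y in sy
  ... | true  | true  rewrite sy = cong (λ w → x ∷ y ∷ w) (slotWord-pair occurs ss x y)
  ... | true  | false rewrite sy = cong (x ∷_) (slotWord-pair occurs ss x y)
  ... | false | true  rewrite sy = cong (y ∷_) (slotWord-pair occurs ss x y)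
  ... | false | false rewrite sy = slotWord-pair occurs ss x y

  length-slotWord-[_] : ∀ (x : A) occurs ss → length (slotWord occurs ss [ x ]) ≡ length (filterᵇ (λ s → occurs s x) ss)
  length-slotWord-[ x ] occurs []       = refl
  length-slotWord-[ x ] occurs (s ∷ ss) with occurs s x
  ... | true  = cong suc (length-slotWord-[ x ] occurs ss)
  ... | false = length-slotWord-[ x ] occurs ss

-- Restricting words to two letters

allFin-suc : ∀ n → allFin (suc n) ≡ Fin.zero ∷ map Fin.suc (allFin n)
allFin-suc n = cong (Fin.zero ∷_) (sym (map-tabulate id Fin.suc))

filter-allFin-≟ : ∀ {n} (v : Fin n) → filter (_≟ v) (allFin n) ≡ [ v ]
filter-allFin-≟ {suc n} Fin.zero = begin
  filter (_≟ Fin.zero) (allFin (suc n))                    ≡⟨ cong (filter (_≟ Fin.zero)) (allFin-suc n) ⟩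
  Fin.zero ∷ filter (_≟ Fin.zero) (map Fin.suc (allFin n))  ≡⟨ cong (Fin.zero ∷_) (filter-map _ Fin.suc (allFin n)) ⟩
  Fin.zero ∷ map Fin.suc (filter _ (allFin n))              ≡⟨ cong (λ l → Fin.zero ∷ map Fin.suc l)
                                                                     (filter-reject-all _ (λ _ → refl) (allFin n)) ⟩
  [ Fin.zero ]                                              ∎
  where open ≡-Reasoning
filter-allFin-≟ {suc n} (Fin.suc v) = begin
  filter (_≟ Fin.suc v) (allFin (suc n))            ≡⟨ cong (filter (_≟ Fin.suc v)) (allFin-suc n) ⟩
  filter (_≟ Fin.suc v) (map Fin.suc (allFin n))    ≡⟨ filter-map _ Fin.suc (allFin n) ⟩
  map Fin.suc (filter _ (allFin n))                 ≡⟨ cong (map Fin.suc) (filter-cong _ (_≟ v) (λ _ → refl) (allFin n)) ⟩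
  map Fin.suc (filter (_≟ v) (allFin n))            ≡⟨ cong (map Fin.suc) (filter-allFin-≟ v) ⟩
  [ Fin.suc v ]                                     ∎
  where open ≡-Reasoning

inIndexOrder : ∀ {n} → Fin n → Fin n → List (Fin n)
inIndexOrder x y = if does (toℕ x <? toℕ y) then x ∷ y ∷ [] else y ∷ x ∷ []

map-suc-inIndexOrder : ∀ {n} (x y : Fin n) → map Fin.suc (inIndexOrder x y) ≡ inIndexOrder (Fin.suc x) (Fin.suc y)
map-suc-inIndexOrder x y with does (toℕ x <? toℕ y)
... | true  = refl
... | false = refl

restrict-allFin : ∀ {n} (x y : Fin n) → x ≢ y → restrict x y (allFin n) ≡ inIndexOrder x y
restrict-allFin {suc n} Fin.zero Fin.zero x≢y = ⊥-elim (x≢y refl)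
restrict-allFin {suc n} Fin.zero (Fin.suc y) _ = begin
  restrict Fin.zero (Fin.suc y) (allFin (suc n))          ≡⟨ cong (restrict Fin.zero (Fin.suc y)) (allFin-suc n) ⟩
  Fin.zero ∷ filter _ (map Fin.suc (allFin n))            ≡⟨ cong (Fin.zero ∷_) (filter-map _ Fin.suc (allFin n)) ⟩
  Fin.zero ∷ map Fin.suc (filter _ (allFin n))            ≡⟨ cong (λ l → Fin.zero ∷ map Fin.suc l)
                                                                   (filter-cong _ (_≟ y) (λ _ → refl) (allFin n)) ⟩
  Fin.zero ∷ map Fin.suc (filter (_≟ y) (allFin n))       ≡⟨ cong (λ l → Fin.zero ∷ map Fin.suc l) (filter-allFin-≟ y) ⟩
  inIndexOrder Fin.zero (Fin.suc y)                        ∎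
  where open ≡-Reasoning
restrict-allFin {suc n} (Fin.suc x) Fin.zero _ = begin
  restrict (Fin.suc x) Fin.zero (allFin (suc n))          ≡⟨ cong (restrict (Fin.suc x) Fin.zero) (allFin-suc n) ⟩
  Fin.zero ∷ filter _ (map Fin.suc (allFin n))            ≡⟨ cong (Fin.zero ∷_) (filter-map _ Fin.suc (allFin n)) ⟩
  Fin.zero ∷ map Fin.suc (filter _ (allFin n))            ≡⟨ cong (λ l → Fin.zero ∷ map Fin.suc l)
                                                                   (filter-cong _ (_≟ x) (λ _ → ∨-identityʳ _) (allFin n)) ⟩
  Fin.zero ∷ map Fin.suc (filter (_≟ x) (allFin n))       ≡⟨ cong (λ l → Fin.zero ∷ map Fin.suc l) (filter-allFin-≟ x) ⟩
  inIndexOrder (Fin.suc x) Fin.zero                        ∎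
  where open ≡-Reasoning
restrict-allFin {suc n} (Fin.suc x) (Fin.suc y) x≢y = begin
  restrict (Fin.suc x) (Fin.suc y) (allFin (suc n))       ≡⟨ cong (restrict (Fin.suc x) (Fin.suc y)) (allFin-suc n) ⟩
  filter _ (map Fin.suc (allFin n))                       ≡⟨ filter-map _ Fin.suc (allFin n) ⟩
  map Fin.suc (filter _ (allFin n))                       ≡⟨ cong (map Fin.suc) (filter-cong _ _ (λ _ → refl) (allFin n)) ⟩
  map Fin.suc (restrict x y (allFin n))                   ≡⟨ cong (map Fin.suc) (restrict-allFin x y (x≢y ∘ cong Fin.suc)) ⟩
  map Fin.suc (inIndexOrder x y)                          ≡⟨ map-suc-inIndexOrder x y ⟩
  inIndexOrder (Fin.suc x) (Fin.suc y)                    ∎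
  where open ≡-Reasoning

altWord-Linked : ∀ {n} {x y : Fin n} → x ≢ y → ∀ k → Linked _≢_ (altWord x y k)
altWord-Linked x≢y zero          = []
altWord-Linked x≢y (suc zero)    = [-]
altWord-Linked x≢y (suc (suc k)) = x≢y ∷ altWord-Linked (x≢y ∘ sym) (suc k)

occ>0⇒∈ : ∀ {n} {v : Fin n} w → 0 < occ v w → v ∈ w
occ>0⇒∈ {v = v} (x ∷ w) occ>0 with x ≟ v
... | yes refl = here refl
... | no _     = there (occ>0⇒∈ w occ>0)

restrict-sym : ∀ {n} (x y : Fin n) w → restrict x y w ≡ restrict y x w
restrict-sym x y = filter-cong _ _ (λ z → ∨-comm (does (z ≟ x)) (does (z ≟ y)))

Alternate-sym : ∀ {n} {x y : Fin n} {w} → Alternate x y w → Alternate y x w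
Alternate-sym {x = x} {y} {w} (k , inj₁ eq) = k , inj₂ (trans (restrict-sym y x w) eq)
Alternate-sym {x = x} {y} {w} (k , inj₂ eq) = k , inj₁ (trans (restrict-sym y x w) eq)

Alternate⇒Linked : ∀ {n} {x y : Fin n} {w} → x ≢ y → Alternate x y w → Linked _≢_ (restrict x y w)
Alternate⇒Linked x≢y (k , inj₁ eq) = subst (Linked _≢_) (sym eq) (altWord-Linked x≢y k)
Alternate⇒Linked x≢y (k , inj₂ eq) = subst (Linked _≢_) (sym eq) (altWord-Linked (x≢y ∘ sym) k)

module _ {n : ℕ} {x y : Fin n} where

  altWord-2*-++ : ∀ i j → altWord x y (2 * i) ++ altWord x y (2 * j) ≡ altWord x y (2 * (i + j))
  altWord-2*-++ zero    j = refl
  altWord-2*-++ (suc i) j = begin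
    altWord x y (2 * suc i) ++ altWord x y (2 * j)       ≡⟨ cong (_++ altWord x y (2 * j)) (altWord-2*-suc i) ⟩
    x ∷ y ∷ (altWord x y (2 * i) ++ altWord x y (2 * j)) ≡⟨ cong (λ w → x ∷ y ∷ w) (altWord-2*-++ i j) ⟩
    x ∷ y ∷ altWord x y (2 * (i + j))                    ≡⟨ sym (altWord-2*-suc (i + j)) ⟩
    altWord x y (2 * suc (i + j))                         ∎
    where
    open ≡-Reasoning
    altWord-2*-suc : ∀ k → altWord x y (2 * suc k) ≡ x ∷ y ∷ altWord x y (2 * k)
    altWord-2*-suc k = cong (altWord x y) (*-suc 2 k)

  module _ (g : ℕ → Word n) where

    concatUpTo-alternating : ∀ {i j} → i ≤′ j → (∀ r → i ≤ r → r < j → g r ≡ altWord x y 2) →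
                             concatUpTo g i ≡ altWord x y (2 * i) → concatUpTo g j ≡ altWord x y (2 * j)
    concatUpTo-alternating ≤′-refl _ base = base
    concatUpTo-alternating {i} (≤′-step {j} i≤j) steady base = begin
      concatUpTo g j ++ g j                   ≡⟨ cong₂ _++_ (concatUpTo-alternating i≤j (λ r i≤r → steady r i≤r ∘ m≤n⇒m≤1+n) base)
                                                            (steady j (≤′⇒≤ i≤j) ≤-refl) ⟩
      altWord x y (2 * j) ++ altWord x y 2    ≡⟨ altWord-2*-++ j 1 ⟩
      altWord x y (2 * (j + 1))               ≡⟨ cong (λ k → altWord x y (2 * k)) (+-comm j 1) ⟩
      altWord x y (2 * suc j)                 ∎
      where open ≡-Reasoning

    concatUpTo-alternating-skip : ∀ r → g r ++ g (suc r) ≡ altWord x y 4 →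
                                  concatUpTo g r ≡ altWord x y (2 * r) → concatUpTo g (2 + r) ≡ altWord x y (2 * (2 + r))
    concatUpTo-alternating-skip r pair base = begin
      (concatUpTo g r ++ g r) ++ g (suc r)    ≡⟨ ++-assoc (concatUpTo g r) (g r) (g (suc r)) ⟩
      concatUpTo g r ++ (g r ++ g (suc r))    ≡⟨ cong₂ _++_ base pair ⟩
      altWord x y (2 * r) ++ altWord x y 4    ≡⟨ altWord-2*-++ r 2 ⟩
      altWord x y (2 * (r + 2))               ≡⟨ cong (λ k → altWord x y (2 * k)) (+-comm r 2) ⟩
      altWord x y (2 * (2 + r))               ∎
      where open ≡-Reasoning

module _ {A : Set} (g : ℕ → List A) where

  length-concatUpTo-steady : ∀ {i j} → i ≤′ j → (∀ r → i ≤ r → r < j → length (g r) ≡ 1) →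
                             length (concatUpTo g i) ≡ i → length (concatUpTo g j) ≡ j
  length-concatUpTo-steady ≤′-refl _ base = base
  length-concatUpTo-steady {i} (≤′-step {j} i≤j) steady base = begin
    length (concatUpTo g j ++ g j)          ≡⟨ length-++ (concatUpTo g j) ⟩
    length (concatUpTo g j) + length (g j)  ≡⟨ cong₂ _+_ (length-concatUpTo-steady i≤j (λ r i≤r → steady r i≤r ∘ m≤n⇒m≤1+n) base)
                                                           (steady j (≤′⇒≤ i≤j) ≤-refl) ⟩
    j + 1                                   ≡⟨ +-comm j 1 ⟩
    suc j                                   ∎
    where open ≡-Reasoning

  length-concatUpTo-skip : ∀ r → length (g r) + length (g (suc r)) ≡ 2 →
                           length (concatUpTo g r) ≡ r → length (concatUpTo g (2 + r)) ≡ 2 + r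
  length-concatUpTo-skip r pair base = begin
    length ((concatUpTo g r ++ g r) ++ g (suc r))                   ≡⟨ cong length (++-assoc (concatUpTo g r) (g r) (g (suc r))) ⟩
    length (concatUpTo g r ++ (g r ++ g (suc r)))                   ≡⟨ length-++ (concatUpTo g r) ⟩
    length (concatUpTo g r) + length (g r ++ g (suc r))             ≡⟨ cong₂ _+_ base (trans (length-++ (g r)) pair) ⟩
    r + 2                                                           ≡⟨ +-comm r 2 ⟩
    2 + r                                                           ∎
    where open ≡-Reasoning

-- Kinds of letters in a round

data Kind : Set where
  single absent atEnd doubledLast : Kind
  doubled : Parity → Kind
  inB     : (nearP nearQ : Bool) → Kind

data AtMostOnce : Kind → Set where
  single : AtMostOnce single
  absent : AtMostOnce absent
  atEnd  : AtMostOnce atEnd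

near : Parity → Bool → Bool → Bool
near 1ℙ p q = p
near 0ℙ p q = q

-- The slots of an ordinary round are
--   single | P | B∼P only | Q | B∼P,Q | P | B∼Q only | Q | B∼neither | atEnd,
-- and those of the last round, with Q the rank-0 vertex and B-kinds taken from round 0, are
--   single | B∼neither | Q | B∼Q only | B∼P,Q | Q | B∼P only,
-- so the last round lists B in the reverse order of round 0.
slotsOf : Bool → Kind → List ℕ
slotsOf _     single            = 0 ∷ []
slotsOf _     absent            = []
slotsOf false atEnd             = 9 ∷ []
slotsOf false (doubled 1ℙ)      = 1 ∷ 5 ∷ []
slotsOf false (doubled 0ℙ)      = 3 ∷ 7 ∷ []
slotsOf false (inB true  false) = 2 ∷ []
slotsOf false (inB true  true)  = 4 ∷ []
slotsOf false (inB false true)  = 6 ∷ []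
slotsOf false (inB false false) = 8 ∷ []
slotsOf true  doubledLast       = 2 ∷ 5 ∷ []
slotsOf true  (inB false false) = 1 ∷ []
slotsOf true  (inB false true)  = 3 ∷ []
slotsOf true  (inB true  true)  = 4 ∷ []
slotsOf true  (inB true  false) = 6 ∷ []
slotsOf _     _                 = []

slotNumbers : List ℕ
slotNumbers = upTo 10

occursAt : Bool → Kind → ℕ → Bool
occursAt final K s = any (s ≡ᵇ_) (slotsOf final K)

multiplicity : Bool → Kind → ℕ
multiplicity final K = length (filterᵇ (occursAt final K) slotNumbers)

roundPattern : {A : Set} → Bool → Kind → Kind → A → A → List A
roundPattern final K K′ x y = twoLetterWord (occursAt final K) (occursAt final K′) x y slotNumbers

roundPattern-cong : ∀ {A : Set} {L L′ K₁ K₁′ K₂ K₂′} {x y : A} → L ≡ L′ → K₁ ≡ K₁′ → K₂ ≡ K₂′ →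
                    roundPattern L K₁ K₂ x y ≡ roundPattern L′ K₁′ K₂′ x y
roundPattern-cong refl refl refl = refl

record BothOrders {A : Set} (P : List A → Set) (final : Bool) (K K′ : Kind) (x y : A) : Set where
  constructor _,_
  field
    xFirst : P (roundPattern final K K′ x y)
    yFirst : P (roundPattern final K′ K y x)

OneEach : {A : Set} → A → A → List A → Set
OneEach x y w = w ≡ x ∷ y ∷ [] ⊎ w ≡ y ∷ x ∷ []

NotAlternating : {A : Set} → List A → Set
NotAlternating w = ¬ Linked _≢_ w

OneEach-++ : ∀ {A : Set} {x y : A} {u v} → OneEach x y u → OneEach x y v → Linked _≢_ (u ++ v) → v ≡ u
OneEach-++ (inj₁ refl) (inj₁ refl) _              = refl
OneEach-++ (inj₁ refl) (inj₂ refl) (_ ∷ y≢y ∷ _) = ⊥-elim (y≢y refl)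
OneEach-++ (inj₂ refl) (inj₁ refl) (_ ∷ x≢x ∷ _) = ⊥-elim (x≢x refl)
OneEach-++ (inj₂ refl) (inj₂ refl) _              = refl

OneEach-reverse : ∀ {A : Set} {x y : A} {w} → x ≢ y → OneEach x y w → w ≢ reverse w
OneEach-reverse x≢y (inj₁ refl) = x≢y ∘ ∷-injectiveˡ
OneEach-reverse x≢y (inj₂ refl) = x≢y ∘ sym ∘ ∷-injectiveˡ

multiplicity-inB : ∀ final p q → multiplicity final (inB p q) ≡ 1
multiplicity-inB false true  true  = refl
multiplicity-inB false true  false = refl
multiplicity-inB false false true  = refl
multiplicity-inB false false false = refl
multiplicity-inB true  true  true  = refl
multiplicity-inB true  true  false = refl
multiplicity-inB true  false true  = refl
multiplicity-inB true  false false = refl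

multiplicity-single : ∀ final → multiplicity final single ≡ 1
multiplicity-single false = refl
multiplicity-single true  = refl

multiplicity-absent : ∀ final → multiplicity final absent ≡ 0
multiplicity-absent false = refl
multiplicity-absent true  = refl

multiplicity-doubled : ∀ p → multiplicity false (doubled p) ≡ 2
multiplicity-doubled 1ℙ = refl
multiplicity-doubled 0ℙ = refl

module _ {A : Set} (x y : A) where

  repeat : ∀ xs {ys} → NotAlternating (xs ++ x ∷ x ∷ ys)
  repeat []       (x≢x ∷ _) = x≢x refl
  repeat (_ ∷ xs) l         = repeat xs (Linked.tail l)

  single-inB : ∀ final p q → BothOrders (_≡ x ∷ y ∷ []) final single (inB p q) x y
  single-inB false true  true  = refl , refl
  single-inB false true  false = refl , refl
  single-inB false false true  = refl , refl
  single-inB false false false = refl , refl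
  single-inB true  true  true  = refl , refl
  single-inB true  true  false = refl , refl
  single-inB true  false true  = refl , refl
  single-inB true  false false = refl , refl

  absent-inB : ∀ final p q → BothOrders (_≡ y ∷ []) final absent (inB p q) x y
  absent-inB false true  true  = refl , refl
  absent-inB false true  false = refl , refl
  absent-inB false false true  = refl , refl
  absent-inB false false false = refl , refl
  absent-inB true  true  true  = refl , refl
  absent-inB true  true  false = refl , refl
  absent-inB true  false true  = refl , refl
  absent-inB true  false false = refl , refl

  atEnd-inB : ∀ p q → BothOrders (_≡ y ∷ x ∷ []) false atEnd (inB p q) x y
  atEnd-inB true  true  = refl , refl
  atEnd-inB true  false = refl , refl
  atEnd-inB false true  = refl , refl
  atEnd-inB false false = refl , refl

  doubled-inB-near : ∀ r p q → near r p q ≡ true → BothOrders (_≡ x ∷ y ∷ x ∷ []) false (doubled r) (inB p q) x y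
  doubled-inB-near 1ℙ true true  _ = refl , refl
  doubled-inB-near 1ℙ true false _ = refl , refl
  doubled-inB-near 0ℙ true true  _ = refl , refl
  doubled-inB-near 0ℙ false true _ = refl , refl

  doubled-inB-far : ∀ r p q → near r p q ≡ false → BothOrders NotAlternating false (doubled r) (inB p q) x y
  doubled-inB-far 1ℙ false true  _ = repeat [] , repeat []
  doubled-inB-far 1ℙ false false _ = repeat [] , repeat []
  doubled-inB-far 0ℙ true  false _ = repeat (y ∷ []) , repeat (y ∷ [])
  doubled-inB-far 0ℙ false false _ = repeat [] , repeat []

  doubledLast-inB-near : ∀ p → BothOrders (_≡ x ∷ y ∷ x ∷ []) true doubledLast (inB p true) x y
  doubledLast-inB-near true  = refl , refl
  doubledLast-inB-near false = refl , refl

  doubledLast-inB-far : ∀ p → BothOrders NotAlternating true doubledLast (inB p false) x y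
  doubledLast-inB-far true  = repeat [] , repeat []
  doubledLast-inB-far false = repeat (y ∷ []) , repeat (y ∷ [])

  doubled-atMostOnce : ∀ r {K} → AtMostOnce K → BothOrders NotAlternating false (doubled r) K x y
  doubled-atMostOnce 1ℙ single = repeat (y ∷ []) , repeat (y ∷ [])
  doubled-atMostOnce 0ℙ single = repeat (y ∷ []) , repeat (y ∷ [])
  doubled-atMostOnce 1ℙ absent = repeat [] , repeat []
  doubled-atMostOnce 0ℙ absent = repeat [] , repeat []
  doubled-atMostOnce 1ℙ atEnd  = repeat [] , repeat []
  doubled-atMostOnce 0ℙ atEnd  = repeat [] , repeat []

  doubled-doubled : BothOrders (_≡ y ∷ x ∷ y ∷ x ∷ []) false (doubled 0ℙ) (doubled 1ℙ) x y
  doubled-doubled = refl , refl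

  single-single : ∀ final → roundPattern final single single x y ≡ x ∷ y ∷ []
  single-single false = refl
  single-single true  = refl

  inB-inB : ∀ final p q p′ q′ → BothOrders (OneEach x y) final (inB p q) (inB p′ q′) x y
  inB-inB false true  true  true  true  = inj₁ refl , inj₂ refl
  inB-inB false true  true  true  false = inj₂ refl , inj₂ refl
  inB-inB false true  true  false true  = inj₁ refl , inj₁ refl
  inB-inB false true  true  false false = inj₁ refl , inj₁ refl
  inB-inB false true  false true  true  = inj₁ refl , inj₁ refl
  inB-inB false true  false true  false = inj₁ refl , inj₂ refl
  inB-inB false true  false false true  = inj₁ refl , inj₁ refl
  inB-inB false true  false false false = inj₁ refl , inj₁ refl
  inB-inB false false true  true  true  = inj₂ refl , inj₂ refl
  inB-inB false false true  true  false = inj₂ refl , inj₂ refl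
  inB-inB false false true  false true  = inj₁ refl , inj₂ refl
  inB-inB false false true  false false = inj₁ refl , inj₁ refl
  inB-inB false false false true  true  = inj₂ refl , inj₂ refl
  inB-inB false false false true  false = inj₂ refl , inj₂ refl
  inB-inB false false false false true  = inj₂ refl , inj₂ refl
  inB-inB false false false false false = inj₁ refl , inj₂ refl
  inB-inB true  true  true  true  true  = inj₁ refl , inj₂ refl
  inB-inB true  true  true  true  false = inj₁ refl , inj₁ refl
  inB-inB true  true  true  false true  = inj₂ refl , inj₂ refl
  inB-inB true  true  true  false false = inj₂ refl , inj₂ refl
  inB-inB true  true  false true  true  = inj₂ refl , inj₂ refl
  inB-inB true  true  false true  false = inj₁ refl , inj₂ refl
  inB-inB true  true  false false true  = inj₂ refl , inj₂ refl
  inB-inB true  true  false false false = inj₂ refl , inj₂ refl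
  inB-inB true  false true  true  true  = inj₁ refl , inj₁ refl
  inB-inB true  false true  true  false = inj₁ refl , inj₁ refl
  inB-inB true  false true  false true  = inj₁ refl , inj₂ refl
  inB-inB true  false true  false false = inj₂ refl , inj₂ refl
  inB-inB true  false false true  true  = inj₁ refl , inj₁ refl
  inB-inB true  false false true  false = inj₁ refl , inj₁ refl
  inB-inB true  false false false true  = inj₁ refl , inj₁ refl
  inB-inB true  false false false false = inj₁ refl , inj₂ refl

  final-reverses : ∀ p q p′ q′ → roundPattern true (inB p′ q′) (inB p q) y x
                                 ≡ reverse (roundPattern false (inB p q) (inB p′ q′) x y)
  final-reverses true  true  true  true  = refl
  final-reverses true  true  true  false = refl
  final-reverses true  true  false true  = refl
  final-reverses true  true  false false = refl
  final-reverses true  false true  true  = refl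
  final-reverses true  false true  false = refl
  final-reverses true  false false true  = refl
  final-reverses true  false false false = refl
  final-reverses false true  true  true  = refl
  final-reverses false true  true  false = refl
  final-reverses false true  false true  = refl
  final-reverses false true  false false = refl
  final-reverses false false true  true  = refl
  final-reverses false false true  false = refl
  final-reverses false false false true  = refl
  final-reverses false false false false = refl

-- The rounds of the representing word

-- The rank of the A-vertex that is the P- (parity 1ℙ) or Q-vertex (parity 0ℙ) of round ρ.
roleRank : Parity → ℕ → ℕ
roleRank 1ℙ ρ = suc (2 * ρ)
roleRank 0ℙ ρ = 2 * ρ

roleRank-parity : ∀ k → roleRank (parity k) ⌊ k /2⌋ ≡ k
roleRank-parity 0             = refl
roleRank-parity 1             = refl
roleRank-parity (suc (suc k)) = trans (roleRank-suc (parity k) ⌊ k /2⌋) (cong (2 +_) (roleRank-parity k))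
  where
  roleRank-suc : ∀ p ρ → roleRank p (suc ρ) ≡ 2 + roleRank p ρ
  roleRank-suc 1ℙ ρ = cong suc (*-suc 2 ρ)
  roleRank-suc 0ℙ ρ = *-suc 2 ρ

near-roleRank : ∀ p ρ (f : ℕ → Bool) → near p (f (roleRank 1ℙ ρ)) (f (roleRank 0ℙ ρ)) ≡ f (roleRank p ρ)
near-roleRank 1ℙ ρ f = refl
near-roleRank 0ℙ ρ f = refl

parity-half-injective : ∀ {k k′} → parity k ≡ parity k′ → ⌊ k /2⌋ ≡ ⌊ k′ /2⌋ → k ≡ k′
parity-half-injective {k} {k′} same-parity same-half =
  trans (sym (roleRank-parity k)) (trans (cong₂ roleRank same-parity same-half) (roleRank-parity k′))

even-half-positive : ∀ {k} → parity (suc k) ≡ 0ℙ → ∃[ ρ₀ ] ⌊ suc k /2⌋ ≡ suc ρ₀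
even-half-positive {suc k} _ = ⌊ k /2⌋ , refl

⌊/2⌋<⌈/2⌉ : ∀ {k m} → k < m → ⌊ k /2⌋ < ⌈ m /2⌉
⌊/2⌋<⌈/2⌉ k<m = ⌊n/2⌋-mono (s≤s k<m)

module Construction {n : ℕ} (G : Graph n) (inA : Fin n → Bool) where

  rank : Fin n → ℕ
  rank v = length (filter (λ z → T? (inA z) ×-dec (toℕ z <? toℕ v)) (allFin n))

  sizeA : ℕ
  sizeA = length (filterᵇ inA (allFin n))

  t : ℕ
  t = ⌈ sizeA /2⌉

  rank<sizeA : ∀ {a} → inA a ≡ true → rank a < sizeA
  rank<sizeA {a} a∈A = length-filter-⊂ _ (T? ∘ inA) proj₁ (∈-allFin a) (<-irrefl refl ∘ proj₂) (T-≡⁻¹ a∈A)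

  rank-monotone : ∀ {a a′} → inA a ≡ true → toℕ a < toℕ a′ → rank a < rank a′
  rank-monotone {a} a∈A a<a′ =
    length-filter-⊂ _ _ (λ (z∈A , z<a) → z∈A , <-trans z<a a<a′) (∈-allFin a) (<-irrefl refl ∘ proj₂) (T-≡⁻¹ a∈A , a<a′)

  rank-injective : ∀ {a a′} → inA a ≡ true → inA a′ ≡ true → rank a ≡ rank a′ → a ≡ a′
  rank-injective {a} {a′} a∈A a′∈A eq with <-cmp (toℕ a) (toℕ a′)
  ... | tri< a<a′ _ _ = ⊥-elim (<-irrefl eq (rank-monotone a∈A a<a′))
  ... | tri≈ _ a≡a′ _ = toℕ-injective a≡a′
  ... | tri> _ _ a′<a = ⊥-elim (<-irrefl (sym eq) (rank-monotone a′∈A a′<a))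

  rank-reflects-< : ∀ {a a′} → inA a ≡ true → inA a′ ≡ true → rank a < rank a′ → toℕ a < toℕ a′
  rank-reflects-< {a} {a′} a∈A a′∈A lt with <-cmp (toℕ a) (toℕ a′)
  ... | tri< a<a′ _ _ = a<a′
  ... | tri≈ _ a≡a′ _ = ⊥-elim (<-irrefl (cong rank (toℕ-injective a≡a′)) lt)
  ... | tri> _ _ a′<a = ⊥-elim (<-asym lt (rank-monotone a′∈A a′<a))

  half-rank<t : ∀ {a} → inA a ≡ true → ⌊ rank a /2⌋ < t
  half-rank<t a∈A = ⌊/2⌋<⌈/2⌉ (rank<sizeA a∈A)

  adjacentToRank : ℕ → Fin n → Bool
  adjacentToRank k b = any (λ z → inA z ∧ (rank z ≡ᵇ k) ∧ Adj G z b) (allFin n)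

  adjacentToRank-rank : ∀ {a} b → inA a ≡ true → adjacentToRank (rank a) b ≡ Adj G a b
  adjacentToRank-rank {a} b a∈A = ⇔→≡ {z = true} (mk⇔ to from)
    where
    to : adjacentToRank (rank a) b ≡ true → Adj G a b ≡ true
    to found with find (any⁻ _ (allFin n) (T-≡⁻¹ found))
    ... | z , _ , hit with Equivalence.to T-∧ hit
    ...   | z∈A , rest with Equivalence.to T-∧ rest
    ...     | same , adj rewrite rank-injective (Equivalence.to T-≡ z∈A) a∈A (≡ᵇ⇒≡ _ _ same) = Equivalence.to T-≡ adj
    from : Adj G a b ≡ true → adjacentToRank (rank a) b ≡ true
    from adj = Equivalence.to T-≡ (any⁺ _ (lose (∈-allFin a)
                 (Equivalence.from T-∧ (T-≡⁻¹ a∈A , Equivalence.from T-∧ (≡⇒≡ᵇ (rank a) (rank a) refl , T-≡⁻¹ adj)))))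

  final : ℕ → Bool
  final r = does (r ℕ.≟ t)

  referenceRound : ℕ → ℕ
  referenceRound r = if final r then 0 else r

  bKind : ℕ → Fin n → Kind
  bKind ρ b = inB (adjacentToRank (roleRank 1ℙ ρ) b) (adjacentToRank (roleRank 0ℙ ρ) b)

  aKind : ℕ → ℕ → Kind
  aKind zero        r = if does (r <? t ∸ 1) then atEnd
                        else if does (r ℕ.≟ t ∸ 1) then absent else doubledLast
  aKind k@(suc _)   r = if does (r ℕ.≟ ⌊ k /2⌋) then doubled (parity k)
                        else if does (r ℕ.≟ suc ⌊ k /2⌋) then absent else single

  kind : ℕ → Fin n → Kind
  kind r v = if inA v then aKind (rank v) r else bKind (referenceRound r) v

  order : ℕ → List (Fin n)
  order r = if final r then reverse (allFin n) else allFin n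

  round : ℕ → Word n
  round r = slotWord (λ s z → occursAt (final r) (kind r z) s) slotNumbers (order r)

  word : ℕ → Word n
  word = concatUpTo round

  kind-A : ∀ {v} r → inA v ≡ true → kind r v ≡ aKind (rank v) r
  kind-A r v∈A rewrite v∈A = refl

  kind-B : ∀ {v} r → inA v ≡ false → kind r v ≡ bKind (referenceRound r) v
  kind-B r v∉A rewrite v∉A = refl

  final-< : ∀ {r} → r < t → final r ≡ false
  final-< {r} r<t = dec-false (r ℕ.≟ t) (<⇒≢ r<t)

  final-t : final t ≡ true
  final-t = dec-true (t ℕ.≟ t) refl

  referenceRound-< : ∀ {r} → r < t → referenceRound r ≡ r
  referenceRound-< r<t rewrite final-< r<t = refl

  referenceRound-t : referenceRound t ≡ 0
  referenceRound-t rewrite final-t = refl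

  A≢B : ∀ {a b} → inA a ≡ true → inA b ≡ false → a ≢ b
  A≢B a∈A b∉A refl = case trans (sym a∈A) b∉A of λ ()

  restrict-order : ∀ {x y} → x ≢ y → ∀ r →
                   restrict x y (order r) ≡ (if final r then reverse (inIndexOrder x y) else inIndexOrder x y)
  restrict-order {x} {y} x≢y r with final r
  ... | true  = trans (filter-reverse _ (allFin n)) (cong reverse (restrict-allFin x y x≢y))
  ... | false = restrict-allFin x y x≢y

  restrict-order-OneEach : ∀ {x y} → x ≢ y → ∀ r → OneEach x y (restrict x y (order r))
  restrict-order-OneEach {x} {y} x≢y r rewrite restrict-order x≢y r with final r | does (toℕ x <? toℕ y)
  ... | true  | true  = inj₂ refl
  ... | true  | false = inj₁ refl
  ... | false | true  = inj₁ refl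
  ... | false | false = inj₂ refl

  restrict-round : ∀ {x y u v} r → restrict x y (order r) ≡ u ∷ v ∷ [] →
                   restrict x y (round r) ≡ roundPattern (final r) (kind r u) (kind r v) u v
  restrict-round {x} {y} {u} {v} r eq = begin
    restrict x y (round r)                                    ≡⟨ filter-slotWord _ occurs slotNumbers (order r) ⟩
    slotWord occurs slotNumbers (restrict x y (order r))      ≡⟨ cong (slotWord occurs slotNumbers) eq ⟩
    slotWord occurs slotNumbers (u ∷ v ∷ [])                  ≡⟨ slotWord-pair occurs slotNumbers u v ⟩
    roundPattern (final r) (kind r u) (kind r v) u v          ∎
    where
    open ≡-Reasoning
    occurs = λ s z → occursAt (final r) (kind r z) s

  restrict-round-with : ∀ {P : Word n → Set} {x y L K K′} r → x ≢ y →
                        final r ≡ L → kind r x ≡ K → kind r y ≡ K′ → BothOrders P L K K′ x y → P (restrict x y (round r))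
  restrict-round-with {P} r x≢y refl refl refl (Pxy , Pyx) with restrict-order-OneEach x≢y r
  ... | inj₁ eq = subst P (sym (restrict-round r eq)) Pxy
  ... | inj₂ eq = subst P (sym (restrict-round r eq)) Pyx

  Linked-restrict-prefix : ∀ {x y i j} → i ≤ j → Linked _≢_ (restrict x y (word j)) → Linked _≢_ (restrict x y (word i))
  Linked-restrict-prefix {x} {y} {i} i≤j linked with concatUpTo-prefix round (≤⇒≤′ i≤j)
  ... | s , eq = Linked-++⁻ˡ (restrict x y (word i)) (subst (Linked _≢_) (trans (cong (restrict x y) eq) (filter-++ _ (word i) s)) linked)

  Linked-restrict-round : ∀ {x y r} → r ≤ t → Linked _≢_ (restrict x y (word (suc t))) → Linked _≢_ (restrict x y (round r))
  Linked-restrict-round {x} {y} {r} r≤t linked =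
    Linked-++⁻ʳ (restrict x y (word r)) (subst (Linked _≢_) (filter-++ _ (word r) (round r)) (Linked-restrict-prefix (s≤s r≤t) linked))

  Linked-restrict-rounds : ∀ {x y r} → suc r ≤ t → Linked _≢_ (restrict x y (word (suc t))) →
                           Linked _≢_ (restrict x y (round r) ++ restrict x y (round (suc r)))
  Linked-restrict-rounds {x} {y} {r} 1+r≤t linked =
    Linked-++⁻ʳ (restrict x y (word r)) (subst (Linked _≢_) split (Linked-restrict-prefix (s≤s 1+r≤t) linked))
    where
    open ≡-Reasoning
    split : restrict x y (word (2 + r)) ≡ restrict x y (word r) ++ (restrict x y (round r) ++ restrict x y (round (suc r)))
    split = begin
      restrict x y ((word r ++ round r) ++ round (suc r))                           ≡⟨ filter-++ _ (word r ++ round r) (round (suc r)) ⟩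
      restrict x y (word r ++ round r) ++ restrict x y (round (suc r))              ≡⟨ cong (_++ restrict x y (round (suc r)))
                                                                                           (filter-++ _ (word r) (round r)) ⟩
      (restrict x y (word r) ++ restrict x y (round r)) ++ restrict x y (round (suc r)) ≡⟨ ++-assoc (restrict x y (word r)) _ _ ⟩
      restrict x y (word r) ++ (restrict x y (round r) ++ restrict x y (round (suc r))) ∎

  restrict-word : ∀ x y k → restrict x y (word k) ≡ concatUpTo (restrict x y ∘ round) k
  restrict-word x y = filter-concatUpTo _ round

  occ-word : ∀ v k → occ v (word k) ≡ length (concatUpTo (filter (_≟ v) ∘ round) k)
  occ-word v k = cong length (filter-concatUpTo (_≟ v) round k)

  occ-round : ∀ v r → occ v (round r) ≡ multiplicity (final r) (kind r v)
  occ-round v r = begin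
    length (filter (_≟ v) (round r))                         ≡⟨ cong length (filter-slotWord (_≟ v) occurs slotNumbers (order r)) ⟩
    length (slotWord occurs slotNumbers (filter (_≟ v) (order r))) ≡⟨ cong (length ∘ slotWord occurs slotNumbers) (only-v (final r)) ⟩
    length (slotWord occurs slotNumbers [ v ])                ≡⟨ length-slotWord-[ v ] occurs slotNumbers ⟩
    multiplicity (final r) (kind r v)                         ∎
    where
    open ≡-Reasoning
    occurs = λ s z → occursAt (final r) (kind r z) s
    only-v : ∀ last → filter (_≟ v) (if last then reverse (allFin n) else allFin n) ≡ [ v ]
    only-v true  = trans (filter-reverse (_≟ v) (allFin n)) (cong reverse (filter-allFin-≟ v))
    only-v false = filter-allFin-≟ v

  module PositiveRank {a} (a∈A : inA a ≡ true) {j} (rank-a : rank a ≡ suc j) where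

    ρ : ℕ
    ρ = ⌊ suc j /2⌋

    ρ<t : ρ < t
    ρ<t = subst (λ k → ⌊ k /2⌋ < t) rank-a (half-rank<t a∈A)

    kind-a : ∀ r → kind r a ≡ aKind (suc j) r
    kind-a r = trans (kind-A r a∈A) (cong (λ k → aKind k r) rank-a)

    kind-ρ : kind ρ a ≡ doubled (parity (suc j))
    kind-ρ rewrite kind-a ρ | dec-true (ρ ℕ.≟ ρ) refl = refl

    kind-suc-ρ : kind (suc ρ) a ≡ absent
    kind-suc-ρ rewrite kind-a (suc ρ) | dec-false (suc ρ ℕ.≟ ρ) 1+n≢n | dec-true (suc ρ ℕ.≟ suc ρ) refl = refl

    kind-other : ∀ r → r ≢ ρ → r ≢ suc ρ → kind r a ≡ single
    kind-other r r≢ρ r≢1+ρ rewrite kind-a r | dec-false (r ℕ.≟ ρ) r≢ρ | dec-false (r ℕ.≟ suc ρ) r≢1+ρ = refl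

    ρ+2≤r⇒r≢ρ : ∀ {r} → 2 + ρ ≤ r → r ≢ ρ
    ρ+2≤r⇒r≢ρ ρ+2≤r = >⇒≢ (<-trans (n<1+n ρ) ρ+2≤r)

    occ-a : occ a (word (suc t)) ≡ suc t
    occ-a = trans (occ-word a (suc t)) (length-concatUpTo-steady g (≤⇒≤′ (s≤s ρ<t)) late
              (length-concatUpTo-skip g ρ pair (length-concatUpTo-steady g z≤′n early refl)))
      where
      g = filter (_≟ a) ∘ round
      once : ∀ r → r ≢ ρ → r ≢ suc ρ → length (g r) ≡ 1
      once r r≢ρ r≢1+ρ =
        trans (occ-round a r) (trans (cong (multiplicity (final r)) (kind-other r r≢ρ r≢1+ρ)) (multiplicity-single (final r)))
      early : ∀ r → 0 ≤ r → r < ρ → length (g r) ≡ 1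
      early r _ r<ρ = once r (<⇒≢ r<ρ) (<⇒≢ (m<n⇒m<1+n r<ρ))
      late : ∀ r → 2 + ρ ≤ r → r < suc t → length (g r) ≡ 1
      late r ρ+2≤r _ = once r (ρ+2≤r⇒r≢ρ ρ+2≤r) (>⇒≢ ρ+2≤r)
      pair : length (g ρ) + length (g (suc ρ)) ≡ 2
      pair = cong₂ _+_
        (trans (occ-round a ρ) (trans (cong₂ multiplicity (final-< ρ<t) kind-ρ) (multiplicity-doubled (parity (suc j)))))
        (trans (occ-round a (suc ρ)) (trans (cong (multiplicity (final (suc ρ))) kind-suc-ρ) (multiplicity-absent (final (suc ρ)))))

    module _ {b} (b∉A : inA b ≡ false) where

      private
        a≢b : a ≢ b
        a≢b = A≢B a∈A b∉A

        nearP nearQ : Bool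
        nearP = adjacentToRank (roleRank 1ℙ (referenceRound ρ)) b
        nearQ = adjacentToRank (roleRank 0ℙ (referenceRound ρ)) b

      near-ρ : near (parity (suc j)) nearP nearQ ≡ Adj G a b
      near-ρ = begin
        near p (f (roleRank 1ℙ (referenceRound ρ))) (f (roleRank 0ℙ (referenceRound ρ))) ≡⟨ near-roleRank p (referenceRound ρ) f ⟩
        f (roleRank p (referenceRound ρ))                                     ≡⟨ cong (f ∘ roleRank p) (referenceRound-< ρ<t) ⟩
        f (roleRank p ρ)                                              ≡⟨ cong f (trans (roleRank-parity (suc j)) (sym rank-a)) ⟩
        f (rank a)                                                    ≡⟨ adjacentToRank-rank b a∈A ⟩
        Adj G a b                                                     ∎
        where
        open ≡-Reasoning
        p = parity (suc j)
        f = λ k → adjacentToRank k b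

      restrict-other : ∀ r → r ≢ ρ → r ≢ suc ρ → restrict a b (round r) ≡ a ∷ b ∷ []
      restrict-other r r≢ρ r≢1+ρ =
        restrict-round-with r a≢b refl (kind-other r r≢ρ r≢1+ρ) (kind-B r b∉A) (single-inB a b (final r) _ _)

      restrict-ρ-adjacent : Adj G a b ≡ true → restrict a b (round ρ) ≡ a ∷ b ∷ a ∷ []
      restrict-ρ-adjacent adj =
        restrict-round-with ρ a≢b (final-< ρ<t) kind-ρ (kind-B ρ b∉A)
          (doubled-inB-near a b (parity (suc j)) nearP nearQ (trans near-ρ adj))

      restrict-ρ-nonadjacent : Adj G a b ≡ false → NotAlternating (restrict a b (round ρ))
      restrict-ρ-nonadjacent nonadj =
        restrict-round-with ρ a≢b (final-< ρ<t) kind-ρ (kind-B ρ b∉A)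
          (doubled-inB-far a b (parity (suc j)) nearP nearQ (trans near-ρ nonadj))

      restrict-suc-ρ : restrict a b (round (suc ρ)) ≡ b ∷ []
      restrict-suc-ρ =
        restrict-round-with (suc ρ) a≢b refl kind-suc-ρ (kind-B (suc ρ) b∉A) (absent-inB a b (final (suc ρ)) _ _)

      adjacent⇒alternates : Adj G a b ≡ true → restrict a b (word (suc t)) ≡ altWord a b (2 * suc t)
      adjacent⇒alternates adj = trans (restrict-word a b (suc t)) (concatUpTo-alternating g (≤⇒≤′ (s≤s ρ<t)) late
        (concatUpTo-alternating-skip g ρ (cong₂ _++_ (restrict-ρ-adjacent adj) restrict-suc-ρ)
          (concatUpTo-alternating g z≤′n early refl)))
        where
        g = restrict a b ∘ round
        early : ∀ r → 0 ≤ r → r < ρ → g r ≡ a ∷ b ∷ []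
        early r _ r<ρ = restrict-other r (<⇒≢ r<ρ) (<⇒≢ (m<n⇒m<1+n r<ρ))
        late : ∀ r → 2 + ρ ≤ r → r < suc t → g r ≡ a ∷ b ∷ []
        late r ρ+2≤r _ = restrict-other r (ρ+2≤r⇒r≢ρ ρ+2≤r) (>⇒≢ ρ+2≤r)

      nonadjacent⇒not-alternating : Adj G a b ≡ false → NotAlternating (restrict a b (word (suc t)))
      nonadjacent⇒not-alternating nonadj = restrict-ρ-nonadjacent nonadj ∘ Linked-restrict-round (<⇒≤ ρ<t)

  A-nonempty⇒0<t : ∀ {a} → inA a ≡ true → 0 < t
  A-nonempty⇒0<t a∈A = ≤-<-trans z≤n (half-rank<t a∈A)

  t≡1+t∸1 : ∀ {a} → inA a ≡ true → t ≡ suc (t ∸ 1)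
  t≡1+t∸1 a∈A = sym (suc-pred t {{>-nonZero (A-nonempty⇒0<t a∈A)}})

  module ZeroRank {a} (a∈A : inA a ≡ true) (rank-a : rank a ≡ 0) where

    t′ : ℕ
    t′ = t ∸ 1

    private
      t≡1+t′ : t ≡ suc t′
      t≡1+t′ = t≡1+t∸1 a∈A

      t′<t : t′ < t
      t′<t = subst (t′ <_) (sym t≡1+t′) (n<1+n t′)

    kind-a : ∀ r → kind r a ≡ aKind 0 r
    kind-a r = trans (kind-A r a∈A) (cong (λ k → aKind k r) rank-a)

    kind-early : ∀ {r} → r < t′ → kind r a ≡ atEnd
    kind-early {r} r<t′ rewrite kind-a r | dec-true (r <? t ∸ 1) r<t′ = refl

    kind-t′ : kind t′ a ≡ absent
    kind-t′ rewrite kind-a t′ | dec-false (t′ <? t ∸ 1) (<-irrefl refl) | dec-true (t′ ℕ.≟ t ∸ 1) refl = refl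

    kind-t : kind t a ≡ doubledLast
    kind-t rewrite kind-a t | dec-false (t <? t ∸ 1) (≤⇒≯ (m∸n≤m t 1))
                 | dec-false (t ℕ.≟ t ∸ 1) (>⇒≢ t′<t) = refl

    occ-a : occ a (word (suc t)) ≡ suc t
    occ-a = trans (occ-word a (suc t)) (subst (λ k → length (concatUpTo g (suc k)) ≡ suc k) (sym t≡1+t′)
              (length-concatUpTo-skip g t′ pair (length-concatUpTo-steady g z≤′n early refl)))
      where
      g = filter (_≟ a) ∘ round
      early : ∀ r → 0 ≤ r → r < t′ → length (g r) ≡ 1
      early r _ r<t′ = trans (occ-round a r) (cong₂ multiplicity (final-< (<-trans r<t′ t′<t)) (kind-early r<t′))
      last-two : length (g t′) + length (g t) ≡ 2
      last-two = cong₂ _+_ (trans (occ-round a t′) (trans (cong (multiplicity (final t′)) kind-t′) (multiplicity-absent (final t′))))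
                           (trans (occ-round a t) (cong₂ multiplicity final-t kind-t))
      pair : length (g t′) + length (g (suc t′)) ≡ 2
      pair = subst (λ k → length (g t′) + length (g k) ≡ 2) t≡1+t′ last-two

    module _ {b} (b∉A : inA b ≡ false) where

      private
        a≢b : a ≢ b
        a≢b = A≢B a∈A b∉A

        nearP : Bool
        nearP = adjacentToRank (roleRank 1ℙ (referenceRound t)) b

      nearQ-t : adjacentToRank (roleRank 0ℙ (referenceRound t)) b ≡ Adj G a b
      nearQ-t = begin
        adjacentToRank (roleRank 0ℙ (referenceRound t)) b ≡⟨ cong (λ r → adjacentToRank (roleRank 0ℙ r) b) referenceRound-t ⟩
        adjacentToRank 0 b                        ≡⟨ cong (λ k → adjacentToRank k b) (sym rank-a) ⟩
        adjacentToRank (rank a) b                 ≡⟨ adjacentToRank-rank b a∈A ⟩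
        Adj G a b                                 ∎
        where open ≡-Reasoning

      kind-t-b : kind t b ≡ inB nearP (Adj G a b)
      kind-t-b = trans (kind-B t b∉A) (cong (inB nearP) nearQ-t)

      restrict-early : ∀ {r} → r < t′ → restrict a b (round r) ≡ b ∷ a ∷ []
      restrict-early {r} r<t′ = restrict-round-with r a≢b (final-< (<-trans r<t′ t′<t)) (kind-early r<t′)
                                  (kind-B r b∉A) (atEnd-inB a b _ _)

      restrict-t′ : restrict a b (round t′) ≡ b ∷ []
      restrict-t′ = restrict-round-with t′ a≢b refl kind-t′ (kind-B t′ b∉A) (absent-inB a b (final t′) _ _)

      restrict-t-adjacent : Adj G a b ≡ true → restrict a b (round t) ≡ a ∷ b ∷ a ∷ []
      restrict-t-adjacent adj = restrict-round-with t a≢b final-t kind-t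
                                  (trans kind-t-b (cong (inB nearP) adj)) (doubledLast-inB-near a b nearP)

      restrict-t-nonadjacent : Adj G a b ≡ false → NotAlternating (restrict a b (round t))
      restrict-t-nonadjacent nonadj = restrict-round-with t a≢b final-t kind-t
                                        (trans kind-t-b (cong (inB nearP) nonadj)) (doubledLast-inB-far a b nearP)

      adjacent⇒alternates : Adj G a b ≡ true → restrict a b (word (suc t)) ≡ altWord b a (2 * suc t)
      adjacent⇒alternates adj = trans (restrict-word a b (suc t))
        (subst (λ k → concatUpTo g (suc k) ≡ altWord b a (2 * suc k)) (sym t≡1+t′)
          (concatUpTo-alternating-skip g t′ pair (concatUpTo-alternating g z≤′n (λ r _ → restrict-early) refl)))
        where
        g = restrict a b ∘ round
        pair : g t′ ++ g (suc t′) ≡ b ∷ a ∷ b ∷ a ∷ []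
        pair = subst (λ k → g t′ ++ g k ≡ b ∷ a ∷ b ∷ a ∷ []) t≡1+t′ (cong₂ _++_ restrict-t′ (restrict-t-adjacent adj))

      nonadjacent⇒not-alternating : Adj G a b ≡ false → NotAlternating (restrict a b (word (suc t)))
      nonadjacent⇒not-alternating nonadj = restrict-t-nonadjacent nonadj ∘ Linked-restrict-round ≤-refl

  restrict-round-ordered : ∀ {x y} r → final r ≡ false → toℕ x < toℕ y →
                           restrict x y (round r) ≡ roundPattern false (kind r x) (kind r y) x y
  restrict-round-ordered {x} {y} r not-final x<y =
    trans (restrict-round r in-order) (roundPattern-cong {K₁ = kind r x} {K₂ = kind r y} not-final refl refl)
    where
    in-order : restrict x y (order r) ≡ x ∷ y ∷ []
    in-order rewrite restrict-order (<⇒≢ x<y ∘ cong toℕ) r | not-final | dec-true (toℕ x <? toℕ y) x<y = refl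

  not-alternating-sym : ∀ {x y} → NotAlternating (restrict y x (word (suc t))) → NotAlternating (restrict x y (word (suc t)))
  not-alternating-sym {x} {y} = subst NotAlternating (restrict-sym y x (word (suc t)))

  doubled-vs-atMostOnce : ∀ {a a′ j} (a∈A : inA a ≡ true) (rank-a : rank a ≡ suc j) → a ≢ a′ →
                          ∀ {K} → AtMostOnce K → kind (PositiveRank.ρ a∈A rank-a) a′ ≡ K →
                          NotAlternating (restrict a a′ (word (suc t)))
  doubled-vs-atMostOnce {a} {a′} a∈A rank-a a≢a′ once kind-a′ =
    restrict-round-with ρ a≢a′ (final-< ρ<t) kind-ρ kind-a′ (doubled-atMostOnce a a′ _ once) ∘ Linked-restrict-round (<⇒≤ ρ<t)
    where open PositiveRank a∈A rank-a

  Q-before-P : ∀ {a a′ j j′} (a∈A : inA a ≡ true) (a′∈A : inA a′ ≡ true)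
               (rank-a : rank a ≡ suc j) (rank-a′ : rank a′ ≡ suc j′) →
               parity (suc j) ≡ 0ℙ → parity (suc j′) ≡ 1ℙ → ⌊ suc j /2⌋ ≡ ⌊ suc j′ /2⌋ →
               NotAlternating (restrict a a′ (word (suc t)))
  Q-before-P {a} {a′} {j} {j′} a∈A a′∈A rank-a rank-a′ even odd same-half with even-half-positive even
  ... | ρ₀ , ρ≡1+ρ₀ =
    repeat a′ a (a ∷ []) ∘ subst (Linked _≢_) (cong₂ _++_ round-ρ₀ round-1+ρ₀) ∘ Linked-restrict-rounds 1+ρ₀≤t
    where
    module Ra  = PositiveRank a∈A rank-a
    module Ra′ = PositiveRank a′∈A rank-a′
    ρ = Ra.ρ
    ρ₀<ρ : ρ₀ < ρ
    ρ₀<ρ = subst (ρ₀ <_) (sym ρ≡1+ρ₀) (n<1+n ρ₀)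
    ρ₀<ρ′ : ρ₀ < Ra′.ρ
    ρ₀<ρ′ = subst (ρ₀ <_) same-half ρ₀<ρ
    ρ₀<t : ρ₀ < t
    ρ₀<t = <-trans ρ₀<ρ Ra.ρ<t
    1+ρ₀≤t : suc ρ₀ ≤ t
    1+ρ₀≤t = subst (_≤ t) ρ≡1+ρ₀ (<⇒≤ Ra.ρ<t)
    a<a′ : toℕ a < toℕ a′
    a<a′ = rank-reflects-< a∈A a′∈A (subst₂ _<_ (sym (trans rank-a rank-a≡)) (sym (trans rank-a′ rank-a′≡)) (n<1+n (2 * ρ)))
      where
      rank-a≡ : suc j ≡ roleRank 0ℙ ρ
      rank-a≡ = trans (sym (roleRank-parity (suc j))) (cong (λ p → roleRank p ρ) even)
      rank-a′≡ : suc j′ ≡ roleRank 1ℙ ρ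
      rank-a′≡ = trans (sym (roleRank-parity (suc j′))) (cong₂ roleRank odd (sym same-half))
    a≢a′ : a ≢ a′
    a≢a′ = <⇒≢ a<a′ ∘ cong toℕ
    round-ρ₀ : restrict a a′ (round ρ₀) ≡ a ∷ a′ ∷ []
    round-ρ₀ = begin
      restrict a a′ (round ρ₀)                                   ≡⟨ restrict-round-ordered ρ₀ (final-< ρ₀<t) a<a′ ⟩
      roundPattern false (kind ρ₀ a) (kind ρ₀ a′) a a′           ≡⟨ cong₂ (λ K K′ → roundPattern false K K′ a a′)
                                                                       (Ra.kind-other ρ₀ (<⇒≢ ρ₀<ρ) (<⇒≢ (m<n⇒m<1+n ρ₀<ρ)))
                                                                       (Ra′.kind-other ρ₀ (<⇒≢ ρ₀<ρ′)
                                                                                          (<⇒≢ (m<n⇒m<1+n ρ₀<ρ′))) ⟩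
      roundPattern false single single a a′                       ≡⟨ single-single a a′ false ⟩
      a ∷ a′ ∷ []                                                 ∎
      where open ≡-Reasoning
    round-ρ : restrict a a′ (round ρ) ≡ a′ ∷ a ∷ a′ ∷ a ∷ []
    round-ρ = restrict-round-with ρ a≢a′ (final-< Ra.ρ<t) (trans Ra.kind-ρ (cong doubled even))
                (trans (cong (λ r → kind r a′) same-half) (trans Ra′.kind-ρ (cong doubled odd))) (doubled-doubled a a′)
    round-1+ρ₀ : restrict a a′ (round (suc ρ₀)) ≡ a′ ∷ a ∷ a′ ∷ a ∷ []
    round-1+ρ₀ = subst (λ r → restrict a a′ (round r) ≡ a′ ∷ a ∷ a′ ∷ a ∷ []) ρ≡1+ρ₀ round-ρ

  same-round-different-roles : ∀ {a a′ k k′} → inA a ≡ true → inA a′ ≡ true → a ≢ a′ →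
                               rank a ≡ k → rank a′ ≡ k′ → ⌊ k /2⌋ ≡ ⌊ k′ /2⌋ → parity k ≢ parity k′
  same-round-different-roles a∈A a′∈A a≢a′ rank-a rank-a′ same-half same-parity =
    a≢a′ (rank-injective a∈A a′∈A (trans rank-a (trans (parity-half-injective same-parity same-half) (sym rank-a′))))

  same-round-not-alternating : ∀ {a a′ j j′} (a∈A : inA a ≡ true) (a′∈A : inA a′ ≡ true) → a ≢ a′ →
                               rank a ≡ suc j → rank a′ ≡ suc j′ → ⌊ suc j /2⌋ ≡ ⌊ suc j′ /2⌋ →
                               NotAlternating (restrict a a′ (word (suc t)))
  same-round-not-alternating {j = j} {j′} a∈A a′∈A a≢a′ rank-a rank-a′ same-half
    with parity (suc j) in pa | parity (suc j′) in pa′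
  ... | 0ℙ | 1ℙ = Q-before-P a∈A a′∈A rank-a rank-a′ pa pa′ same-half
  ... | 1ℙ | 0ℙ = not-alternating-sym (Q-before-P a′∈A a∈A rank-a′ rank-a pa′ pa (sym same-half))
  ... | 0ℙ | 0ℙ = ⊥-elim (same-round-different-roles a∈A a′∈A a≢a′ rank-a rank-a′ same-half (trans pa (sym pa′)))
  ... | 1ℙ | 1ℙ = ⊥-elim (same-round-different-roles a∈A a′∈A a≢a′ rank-a rank-a′ same-half (trans pa (sym pa′)))

  positive-rank-not-alternating : ∀ {a a′ j} (a∈A : inA a ≡ true) (a′∈A : inA a′ ≡ true) → a ≢ a′ →
                                  (rank-a : rank a ≡ suc j) →
                            NotAlternating (restrict a a′ (word (suc t)))
  positive-rank-not-alternating {a} {a′} a∈A a′∈A a≢a′ rank-a with rank a′ in rank-a′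
  ... | zero with <-cmp (PositiveRank.ρ a∈A rank-a) (t ∸ 1)
  ...   | tri< ρ<t′ _ _ = doubled-vs-atMostOnce a∈A rank-a a≢a′ atEnd (ZeroRank.kind-early a′∈A rank-a′ ρ<t′)
  ...   | tri≈ _ ρ≡t′ _ = doubled-vs-atMostOnce a∈A rank-a a≢a′ absent
                            (subst (λ r → kind r a′ ≡ absent) (sym ρ≡t′) (ZeroRank.kind-t′ a′∈A rank-a′))
  ...   | tri> _ _ t′<ρ = ⊥-elim (<⇒≱ (PositiveRank.ρ<t a∈A rank-a) (subst (_≤ _) (sym (t≡1+t∸1 a′∈A)) t′<ρ))
  positive-rank-not-alternating {a} {a′} a∈A a′∈A a≢a′ rank-a | suc j′
    with PositiveRank.ρ a∈A rank-a ℕ.≟ PositiveRank.ρ a′∈A rank-a′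
  ...   | yes same-half = same-round-not-alternating a∈A a′∈A a≢a′ rank-a rank-a′ same-half
  ...   | no ρ≢ρ′ with PositiveRank.ρ a∈A rank-a ℕ.≟ suc (PositiveRank.ρ a′∈A rank-a′)
  ...     | yes ρ≡1+ρ′ = doubled-vs-atMostOnce a∈A rank-a a≢a′ absent
                           (subst (λ r → kind r a′ ≡ absent) (sym ρ≡1+ρ′) (PositiveRank.kind-suc-ρ a′∈A rank-a′))
  ...     | no ρ≢1+ρ′  = doubled-vs-atMostOnce a∈A rank-a a≢a′ single
                           (PositiveRank.kind-other a′∈A rank-a′ _ ρ≢ρ′ ρ≢1+ρ′)

  A-not-alternating : ∀ {a a′} → inA a ≡ true → inA a′ ≡ true → a ≢ a′ → NotAlternating (restrict a a′ (word (suc t)))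
  A-not-alternating {a} {a′} a∈A a′∈A a≢a′ with rank a in rank-a | rank a′ in rank-a′
  ... | suc _ | _     = positive-rank-not-alternating a∈A a′∈A a≢a′ rank-a
  ... | zero  | suc _ = not-alternating-sym (positive-rank-not-alternating a′∈A a∈A (a≢a′ ∘ sym) rank-a′)
  ... | zero  | zero  = ⊥-elim (a≢a′ (rank-injective a∈A a′∈A (trans rank-a (sym rank-a′))))

  restrict-order-final : ∀ {x y} → 0 < t → x ≢ y → restrict x y (order t) ≡ reverse (restrict x y (order 0))
  restrict-order-final 0<t x≢y rewrite restrict-order x≢y t | restrict-order x≢y 0 | final-t | final-< 0<t = refl

  kind-B-final : ∀ {w} → inA w ≡ false → kind t w ≡ bKind 0 w
  kind-B-final w∉A = trans (kind-B t w∉A) (cong (λ ρ → bKind ρ _) referenceRound-t)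

  kind-B-initial : ∀ {w} → 0 < t → inA w ≡ false → kind 0 w ≡ bKind 0 w
  kind-B-initial 0<t w∉A = trans (kind-B 0 w∉A) (cong (λ ρ → bKind ρ _) (referenceRound-< 0<t))

  final-round-reverses : ∀ {x y u v} → 0 < t → x ≢ y → inA u ≡ false → inA v ≡ false →
                         restrict x y (order 0) ≡ u ∷ v ∷ [] →
                         restrict x y (round t) ≡ reverse (restrict x y (round 0))
  final-round-reverses {x} {y} {u} {v} 0<t x≢y u∉A v∉A order-0 = begin
    restrict x y (round t)                                        ≡⟨ restrict-round t (trans (restrict-order-final 0<t x≢y)
                                                                                                   (cong reverse order-0)) ⟩
    roundPattern (final t) (kind t v) (kind t u) v u              ≡⟨ roundPattern-cong final-t (kind-B-final v∉A) (kind-B-final u∉A) ⟩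
    roundPattern true (bKind 0 v) (bKind 0 u) v u                 ≡⟨ final-reverses u v (adjacentToRank 1 u) (adjacentToRank 0 u)
                                                                                         (adjacentToRank 1 v) (adjacentToRank 0 v) ⟩
    reverse (roundPattern false (bKind 0 u) (bKind 0 v) u v)      ≡⟨ cong reverse (roundPattern-cong (sym (final-< 0<t))
                                                                       (sym (kind-B-initial 0<t u∉A)) (sym (kind-B-initial 0<t v∉A))) ⟩
    reverse (roundPattern (final 0) (kind 0 u) (kind 0 v) u v)    ≡⟨ cong reverse (sym (restrict-round 0 order-0)) ⟩
    reverse (restrict x y (round 0))                              ∎
    where open ≡-Reasoning

  module _ {b b′} (b∉A : inA b ≡ false) (b′∉A : inA b′ ≡ false) (b≢b′ : b ≢ b′) where

    restrict-round-OneEach : ∀ r → OneEach b b′ (restrict b b′ (round r))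
    restrict-round-OneEach r = restrict-round-with r b≢b′ refl (kind-B r b∉A) (kind-B r b′∉A)
                                 (inB-inB b b′ _ _ _ _ _)

    restrict-rounds-constant : Linked _≢_ (restrict b b′ (word (suc t))) →
                               ∀ r → r ≤ t → restrict b b′ (round r) ≡ restrict b b′ (round 0)
    restrict-rounds-constant linked zero    _     = refl
    restrict-rounds-constant linked (suc r) 1+r≤t =
      trans (OneEach-++ (restrict-round-OneEach r) (restrict-round-OneEach (suc r)) (Linked-restrict-rounds 1+r≤t linked))
            (restrict-rounds-constant linked r (<⇒≤ 1+r≤t))

    B-not-alternating : 0 < t → NotAlternating (restrict b b′ (word (suc t)))
    B-not-alternating 0<t linked =
      OneEach-reverse b≢b′ (restrict-round-OneEach 0) (trans (sym (restrict-rounds-constant linked t ≤-refl)) final-reversed)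
      where
      final-reversed : restrict b b′ (round t) ≡ reverse (restrict b b′ (round 0))
      final-reversed with restrict-order-OneEach b≢b′ 0
      ... | inj₁ order-0 = final-round-reverses 0<t b≢b′ b∉A b′∉A order-0
      ... | inj₂ order-0 = final-round-reverses 0<t b≢b′ b′∉A b∉A order-0

  occ-word-final : ∀ v → occ v (word (suc t)) ≡ suc t
  occ-word-final v with inA v in v∈A | rank v in rank-v
  ... | true  | suc _ = PositiveRank.occ-a v∈A rank-v
  ... | true  | zero  = ZeroRank.occ-a v∈A rank-v
  ... | false | _     = trans (occ-word v (suc t)) (length-concatUpTo-steady _ z≤′n once refl)
    where
    once : ∀ r → 0 ≤ r → r < suc t → occ v (round r) ≡ 1
    once r _ _ = trans (occ-round v r) (trans (cong (multiplicity (final r)) (kind-B r v∈A)) (multiplicity-inB (final r) _ _))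

  not-alternating⇒nonadjacent : ∀ {a b} → a ≢ b → (Adj G a b ≡ false → NotAlternating (restrict a b (word (suc t)))) →
                                Alternate a b (word (suc t)) → T (Adj G a b)
  not-alternating⇒nonadjacent a≢b nonadjacent⇒ alternate =
    T-≡⁻¹ (¬-not (λ nonadj → nonadjacent⇒ nonadj (Alternate⇒Linked {w = word (suc t)} a≢b alternate)))

  A-B-alternation : ∀ {a b} → inA a ≡ true → inA b ≡ false → T (Adj G a b) ⇔ Alternate a b (word (suc t))
  A-B-alternation {a} {b} a∈A b∉A with rank a in rank-a
  ... | suc _ = mk⇔ (λ adj → 2 * suc t , inj₁ (PositiveRank.adjacent⇒alternates a∈A rank-a b∉A (Equivalence.to T-≡ adj)))
                    (not-alternating⇒nonadjacent (A≢B a∈A b∉A) (PositiveRank.nonadjacent⇒not-alternating a∈A rank-a b∉A))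
  ... | zero  = mk⇔ (λ adj → 2 * suc t , inj₂ (ZeroRank.adjacent⇒alternates a∈A rank-a b∉A (Equivalence.to T-≡ adj)))
                    (not-alternating⇒nonadjacent (A≢B a∈A b∉A) (ZeroRank.nonadjacent⇒not-alternating a∈A rank-a b∉A))

  module _ (edges-cross : ∀ x y → T (Adj G x y) → inA x ≢ inA y) (connected : Connected G) where

    B-pair-not-alternating : ∀ {b b′} → inA b ≡ false → inA b′ ≡ false → b ≢ b′ →
                             NotAlternating (restrict b b′ (word (suc t)))
    B-pair-not-alternating {b} {b′} b∉A b′∉A b≢b′ with 0 <? t
    ... | yes 0<t = B-not-alternating b∉A b′∉A b≢b′ 0<t
    ... | no  t≯0 = ⊥-elim (no-path (connected b b′))
      where
      no-path : Reachable G b b′ → ⊥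
      no-path here = b≢b′ refl
      no-path (step {y = z} adj _) with inA z in z∈A
      ... | true  = t≯0 (A-nonempty⇒0<t z∈A)
      ... | false = edges-cross b z adj (trans b∉A (sym z∈A))

    alternation : ∀ x y → x ≢ y → T (Adj G x y) ⇔ Alternate x y (word (suc t))
    alternation x y x≢y = by-sides (inA x) (inA y) refl refl
      where
      no-edge : inA x ≡ inA y → ¬ T (Adj G x y)
      no-edge same adj = edges-cross x y adj same
      by-sides : ∀ p q → inA x ≡ p → inA y ≡ q → T (Adj G x y) ⇔ Alternate x y (word (suc t))
      by-sides true  false x∈A y∉A = A-B-alternation x∈A y∉A
      by-sides false true  x∉A y∈A =
        mk⇔ (Alternate-sym {w = word (suc t)} ∘ Equivalence.to (A-B-alternation y∈A x∉A) ∘ subst T (Adj-sym G x y))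
            (subst T (Adj-sym G y x) ∘ Equivalence.from (A-B-alternation y∈A x∉A) ∘ Alternate-sym {w = word (suc t)})
      by-sides true  true  x∈A y∈A = mk⇔ (⊥-elim ∘ no-edge (trans x∈A (sym y∈A)))
                                          (⊥-elim ∘ A-not-alternating x∈A y∈A x≢y ∘ Alternate⇒Linked {w = word (suc t)} x≢y)
      by-sides false false x∉A y∉A = mk⇔ (⊥-elim ∘ no-edge (trans x∉A (sym y∉A)))
                                          (⊥-elim ∘ B-pair-not-alternating x∉A y∉A x≢y ∘ Alternate⇒Linked {w = word (suc t)} x≢y)

    representable : KRepresentable (suc t) G
    representable = word (suc t) , occ-word-final , contains-all , alternation
      where
      contains-all : ∀ v → v ∈ word (suc t)
      contains-all v = occ>0⇒∈ (word (suc t)) (subst (0 <_) (sym (occ-word-final v)) (s≤s z≤n))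

does-≟-injective : ∀ (b₁ b₂ b : Bool) → does (b₁ Bool.≟ b) ≡ does (b₂ Bool.≟ b) → b₁ ≡ b₂
does-≟-injective true  true  _     _  = refl
does-≟-injective false false _     _  = refl
does-≟-injective true  false true  ()
does-≟-injective true  false false ()
does-≟-injective false true  true  ()
does-≟-injective false true  false ()

smallest-part : ∀ {n} (c : Fin n → Bool) → ∃[ side ] partSize c side ≡ smallestPart c
smallest-part c with ⊓-sel (partSize c true) (partSize c false)
... | inj₁ eq = true  , sym eq
... | inj₂ eq = false , sym eq

corollary1 : ∀ (n : ℕ) (G : Graph n) (c : Fin n → Bool) →
    Connected G → Reduced G → ProperBipartition G c →
    RepNumberAtMost G (1 + ⌈ smallestPart c /2⌉)
corollary1 n G c connected _ proper with smallest-part c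
... | side , smallest = suc t , ≤-reflexive (cong (λ m → suc ⌈ m /2⌉) (trans sizeA≡ smallest)) , representable edges-cross connected
  where
  inSide : Fin n → Bool
  inSide v = does (c v Bool.≟ side)
  open Construction G inSide
  sizeA≡ : sizeA ≡ partSize c side
  sizeA≡ = cong length (filter-cong _ _ (λ _ → refl) (allFin n))
  edges-cross : ∀ x y → T (Adj G x y) → inSide x ≢ inSide y
  edges-cross x y adj = proper x y adj ∘ does-≟-injective (c x) (c y) side
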